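{- Let $\Omega_S$ be the infinite square lattice graph (vertex set $\mathbb{Z}^2$, with two vertices adjacent if and only if they are at Euclidean distance $1$). Then $\chi_{td}(\Omega_S)=8$.
   Context: For a (possibly infinite) graph $G$ and a positive integer $k$, a proper $k$-total difference labeling of $G$ is a function $f$ from $V(G)\cup E(G)$ to $\{1,2,\dots,k\}$ such that: (1) for every edge $\{u,v\}$, $f(\{u,v\})=|f(u)-f(v)|$; (2) adjacent vertices receive different labels; (3) two edges sharing a vertex receive different labels; (4) no edge receives the same label as one of its endpoints. $\chi_{td}(G)$ denotes the smallest $k$ for which $G$ has a proper $k$-total difference labeling. -}

module Defs where

open import Level using (Level; suc; _⊔_)
open import Data.Nat using (ℕ; _≤_; ∣_-_∣)
open import Data.Integer as ℤ using (ℤ)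
open import Data.Product using (_×_; _,_; Σ-syntax)
open import Relation.Binary.PropositionalEquality using (_≡_; _≢_)
open import Relation.Nullary using (¬_)

-- Edges are the pairs {u,v} with Adj u v; conditions below are stated
-- for all ordered adjacent pairs, which covers both orientations.
record Graph (a ℓ : Level) : Set (suc (a ⊔ ℓ)) where
  field
    V      : Set a
    Adj    : V → V → Set ℓ

InRange : ℕ → ℕ → Set
InRange k x = 1 ≤ x × x ≤ k

-- The labeling f on V(G) ∪ E(G)
-- is determined by its restriction to vertices (condition (1) forces
-- f({u,v}) = |f(u) - f(v)|), so we record only the vertex part and
-- define the edge label as the absolute difference.
record IsTotalDiffLabeling {a ℓ} (G : Graph a ℓ) (k : ℕ) (f : Graph.V G → ℕ) : Set (a ⊔ ℓ) where
  open Graph G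
  edgeLabel : V → V → ℕ
  edgeLabel u v = ∣ f u - f v ∣
  field
    vertexRange : ∀ v → InRange k (f v)
    edgeRange   : ∀ {u v} → Adj u v → InRange k (edgeLabel u v)
    vertexProper : ∀ {u v} → Adj u v → f u ≢ f v
    edgeProper : ∀ {u v w} → Adj u v → Adj u w → v ≢ w → edgeLabel u v ≢ edgeLabel u w
    edgeVertex : ∀ {u v} → Adj u v → edgeLabel u v ≢ f u

HasTotalDiffLabeling : ∀ {a ℓ} → Graph a ℓ → ℕ → Set (a ⊔ ℓ)
HasTotalDiffLabeling G k = Σ[ f ∈ (Graph.V G → ℕ) ] IsTotalDiffLabeling G k f

χtd≡ : ∀ {a ℓ} → Graph a ℓ → ℕ → Set (a ⊔ ℓ)
χtd≡ G m = HasTotalDiffLabeling G m × (∀ k → HasTotalDiffLabeling G k → m ≤ k)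

SqAdj : ℤ × ℤ → ℤ × ℤ → Set
SqAdj (x , y) (x' , y') = (x ℤ.- x') ℤ.* (x ℤ.- x') ℤ.+ (y ℤ.- y') ℤ.* (y ℤ.- y') ≡ ℤ.+ 1


ΩS : Graph _ _
ΩS = record { V = ℤ × ℤ ; Adj = SqAdj }

-- A vertex label together with the labels of the four neighbours forms a
-- good star when the four edges at that vertex satisfy conditions (2)–(4).
-- Lower bound: a finite search shows that a good star labelled from
-- {1,…,7} is never centred at 3 or 4, one labelled from {1,2,5,6,7} is
-- centred at 5 or 7, and none is labelled from {5,7} alone.  Every vertex
-- of Ω_S is the centre of a good star, so applying these three facts
-- everywhere in turn leaves no label for any vertex.
-- Upper bound: give (x , y) the (x + 2y mod 6)-th entry of 1, 3, 7, 2, 6, 8.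
-- The four neighbours shift the residue by +1, -1, +2 and -2, so only six
-- stars occur, and each of them is good.

module Submission where

open import Defs
open import Data.Nat using (ℕ; zero; suc; _≤_; s≤s; ∣_-_∣)
open import Data.Nat.Properties
  using (_≟_; _≤?_; ≤-trans; ≰⇒>; ⊔-lub; ∣-∣-comm; ∣m-n∣≤m⊔n; ∣m-n∣≡0⇒m≡n; n≢0⇒n>0; +-comm)
open import Data.Integer as ℤ using (ℤ; +_; -[1+_]; _+_; _-_; _*_)
open import Data.Integer.Properties using (+-0-abelianGroup)
open import Data.Integer.Tactic.RingSolver using (solve-∀)
open import Algebra.Bundles using (AbelianGroup)
open import Algebra.Properties.Group (AbelianGroup.group +-0-abelianGroup) using () renaming (∙-cancelˡ to +-cancelˡ)
open import Data.Fin using (Fin)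
open import Data.Fin.Patterns using (0F; 1F; 2F; 3F; 4F; 5F)
open import Data.Fin.Properties using (all?) renaming (_≟_ to _≟ᶠ_)
open import Data.Vec.Functional using (Vector) renaming (_∷_ to _◂_; [] to ◆)
open import Data.List using (List; []; _∷_; applyUpTo)
open import Data.List.Relation.Unary.All as All using (All)
open import Data.List.Membership.Propositional using (_∈_)
open import Data.List.Membership.Propositional.Properties using (∈-applyUpTo⁺)
open import Data.List.Membership.DecPropositional _≟_ using (_∈?_)
open import Data.Product using (_×_; _,_; proj₁; proj₂; ∃-syntax)
open import Data.Product.Properties using (≡-dec)
open import Data.List.Relation.Unary.Any.Properties using (¬Any[])
open import Data.Empty using (⊥-elim)
open import Function using (_∘_)
open import Relation.Nullary using (¬_; Dec; yes; no; ¬?; _×-dec_; _→-dec_)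
open import Relation.Nullary.Decidable using (from-yes)
open import Relation.Binary.PropositionalEquality

-- The third component of GoodEdge is condition (4) seen from the neighbour.

GoodEdge : ℕ → ℕ → Set
GoodEdge a b = a ≢ b × ∣ a - b ∣ ≢ a × ∣ a - b ∣ ≢ b

GoodStar : ℕ → Vector ℕ 4 → Set
GoodStar a b = (∀ i → GoodEdge a (b i)) × (∀ i j → i ≢ j → ∣ a - b i ∣ ≢ ∣ a - b j ∣)

goodEdge? : ∀ a b → Dec (GoodEdge a b)
goodEdge? a b = ¬? (a ≟ b) ×-dec ¬? (∣ a - b ∣ ≟ a) ×-dec ¬? (∣ a - b ∣ ≟ b)

goodStar? : ∀ a b → Dec (GoodStar a b)
goodStar? a b =
  all? (λ i → goodEdge? a (b i)) ×-dec
  all? (λ i → all? (λ j → ¬? (i ≟ᶠ j) →-dec ¬? (∣ a - b i ∣ ≟ ∣ a - b j ∣)))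

GoodStar-resp : ∀ {a b c} → (∀ i → b i ≡ c i) → GoodStar a b → GoodStar a c
GoodStar-resp {a} b≗c (edges , distinct) =
  (λ i → subst (GoodEdge a) (b≗c i) (edges i)) ,
  (λ i j i≢j → subst₂ (λ x y → ∣ a - x ∣ ≢ ∣ a - y ∣) (b≗c i) (b≗c j) (distinct i j i≢j))

CentresIn : List ℕ → List ℕ → Set
CentresIn S S' = ∀ {a b} → a ∈ S → (∀ i → b i ∈ S) → GoodStar a b → a ∈ S'

StarTable : List ℕ → List ℕ → Set
StarTable S S' = All (λ a → All (λ b₀ → All (λ b₁ → All (λ b₂ → All (λ b₃ →
  GoodStar a (b₀ ◂ b₁ ◂ b₂ ◂ b₃ ◂ ◆) → a ∈ S') S) S) S) S) S

starTable? : ∀ S S' → Dec (StarTable S S')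
starTable? S S' = All.all? (λ a → All.all? (λ b₀ → All.all? (λ b₁ → All.all? (λ b₂ → All.all? (λ b₃ →
  goodStar? a (b₀ ◂ b₁ ◂ b₂ ◂ b₃ ◂ ◆) →-dec (a ∈? S')) S) S) S) S) S

starTable⇒centresIn : ∀ {S S'} → StarTable S S' → CentresIn S S'
starTable⇒centresIn table {a} {b} a∈S b∈S good =
  All.lookup (All.lookup (All.lookup (All.lookup (All.lookup table a∈S)
    (b∈S 0F)) (b∈S 1F)) (b∈S 2F)) (b∈S 3F) (GoodStar-resp unfold good)
  where
  unfold : ∀ i → b i ≡ (b 0F ◂ b 1F ◂ b 2F ◂ b 3F ◂ ◆) i
  unfold 0F = refl
  unfold 1F = refl
  unfold 2F = refl
  unfold 3F = refl

peel : ∀ {V : Set} (nbr : Fin 4 → V → V) (f : V → ℕ) {S S'} →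
       (∀ u → GoodStar (f u) (λ i → f (nbr i u))) →
       CentresIn S S' → (∀ u → f u ∈ S) → ∀ u → f u ∈ S'
peel nbr f good centres f∈S u = centres (f∈S u) (λ i → f∈S (nbr i u)) (good u)

Labels : ℕ → List ℕ
Labels k = applyUpTo suc k

inRange⇒∈Labels : ∀ {k x} → InRange k x → x ∈ Labels k
inRange⇒∈Labels {x = suc _} (_ , x≤k) = ∈-applyUpTo⁺ suc x≤k

centres₁ : CentresIn (Labels 7) (1 ∷ 2 ∷ 5 ∷ 6 ∷ 7 ∷ [])
centres₁ = starTable⇒centresIn (from-yes (starTable? (Labels 7) (1 ∷ 2 ∷ 5 ∷ 6 ∷ 7 ∷ [])))

centres₂ : CentresIn (1 ∷ 2 ∷ 5 ∷ 6 ∷ 7 ∷ []) (5 ∷ 7 ∷ [])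
centres₂ = starTable⇒centresIn (from-yes (starTable? (1 ∷ 2 ∷ 5 ∷ 6 ∷ 7 ∷ []) (5 ∷ 7 ∷ [])))

centres₃ : CentresIn (5 ∷ 7 ∷ []) []
centres₃ = starTable⇒centresIn (from-yes (starTable? (5 ∷ 7 ∷ []) []))

Point : Set
Point = ℤ × ℤ

unit : Fin 4 → Point
unit 0F = + 1 , + 0
unit 1F = -[1+ 0 ] , + 0
unit 2F = + 0 , + 1
unit 3F = + 0 , -[1+ 0 ]

_⊕_ : Point → Point → Point
(x , y) ⊕ (a , b) = x + a , y + b

step : Fin 4 → Point → Point
step i u = u ⊕ unit i

norm-one⇒unit : ∀ a b → a * a + b * b ≡ + 1 → ∃[ i ] unit i ≡ (a , b)
norm-one⇒unit (+ 0) (+ 0) ()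
norm-one⇒unit (+ 0) (+ 1) _ = 2F , refl
norm-one⇒unit (+ 0) (+ suc (suc _)) ()
norm-one⇒unit (+ 0) -[1+ 0 ] _ = 3F , refl
norm-one⇒unit (+ 0) -[1+ suc _ ] ()
norm-one⇒unit (+ 1) (+ 0) _ = 0F , refl
norm-one⇒unit (+ 1) (+ suc _) ()
norm-one⇒unit (+ 1) -[1+ _ ] ()
norm-one⇒unit (+ suc (suc _)) (+ 0) ()
norm-one⇒unit (+ suc (suc _)) (+ suc _) ()
norm-one⇒unit (+ suc (suc _)) -[1+ _ ] ()
norm-one⇒unit -[1+ 0 ] (+ 0) _ = 1F , refl
norm-one⇒unit -[1+ 0 ] (+ suc _) ()
norm-one⇒unit -[1+ 0 ] -[1+ _ ] ()
norm-one⇒unit -[1+ suc _ ] (+ 0) ()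
norm-one⇒unit -[1+ suc _ ] (+ suc _) ()
norm-one⇒unit -[1+ suc _ ] -[1+ _ ] ()

unit-norm : ∀ i → proj₁ (unit i) * proj₁ (unit i) + proj₂ (unit i) * proj₂ (unit i) ≡ + 1
unit-norm 0F = refl
unit-norm 1F = refl
unit-norm 2F = refl
unit-norm 3F = refl

unit-injective : ∀ i j → unit i ≡ unit j → i ≡ j
unit-injective = from-yes (all? λ i → all? λ j → ≡-dec ℤ._≟_ ℤ._≟_ (unit i) (unit j) →-dec (i ≟ᶠ j))

SqAdj-sym : ∀ u v → SqAdj u v → SqAdj v u
SqAdj-sym (x , y) (x' , y') = trans (sqDist-comm x y x' y')
  where
  sqDist-comm : ∀ x y x' y' → (x' - x) * (x' - x) + (y' - y) * (y' - y) ≡ (x - x') * (x - x') + (y - y') * (y - y')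
  sqDist-comm = solve-∀

step-adjacent : ∀ i u → SqAdj (step i u) u
step-adjacent i (x , y) = trans (sqDist x y (proj₁ (unit i)) (proj₂ (unit i))) (unit-norm i)
  where
  sqDist : ∀ x y a b → ((x + a) - x) * ((x + a) - x) + ((y + b) - y) * ((y + b) - y) ≡ a * a + b * b
  sqDist = solve-∀

adjacent-step : ∀ i u → SqAdj u (step i u)
adjacent-step i u = SqAdj-sym (step i u) u (step-adjacent i u)

adjacent⇒step : ∀ {u v} → SqAdj u v → ∃[ i ] v ≡ step i u
adjacent⇒step {x , y} {x' , y'} adj =
  let i , unit≡ = norm-one⇒unit (x' - x) (y' - y) (SqAdj-sym (x , y) (x' , y') adj)
  in i , trans (sym (cong₂ _,_ (cancel x x') (cancel y y'))) (cong ((x , y) ⊕_) (sym unit≡))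
  where
  cancel : ∀ x x' → x + (x' - x) ≡ x'
  cancel = solve-∀

step-injective : ∀ {i j} u → step i u ≡ step j u → i ≡ j
step-injective {i} {j} (x , y) eq =
  unit-injective i j (cong₂ _,_ (+-cancelˡ x _ _ (cong proj₁ eq)) (+-cancelˡ y _ _ (cong proj₂ eq)))

star : (Point → ℕ) → Point → Vector ℕ 4
star f u i = f (step i u)

labeling⇒goodStar : ∀ {k f} → IsTotalDiffLabeling ΩS k f → ∀ u → GoodStar (f u) (star f u)
labeling⇒goodStar {f = f} proper u = goodEdge , distinct
  where
  open IsTotalDiffLabeling proper
  goodEdge : ∀ i → GoodEdge (f u) (f (step i u))
  goodEdge i =
    vertexProper (adjacent-step i u) ,
    edgeVertex (adjacent-step i u) ,
    λ eq → edgeVertex (step-adjacent i u) (trans (∣-∣-comm (f (step i u)) (f u)) eq)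
  distinct : ∀ i j → i ≢ j → ∣ f u - f (step i u) ∣ ≢ ∣ f u - f (step j u) ∣
  distinct i j i≢j = edgeProper (adjacent-step i u) (adjacent-step j u) (i≢j ∘ step-injective u)

difference-inRange : ∀ {k a b} → InRange k a → InRange k b → a ≢ b → InRange k ∣ a - b ∣
difference-inRange {a = a} {b} (_ , a≤k) (_ , b≤k) a≢b =
  n≢0⇒n>0 (a≢b ∘ ∣m-n∣≡0⇒m≡n) , ≤-trans (∣m-n∣≤m⊔n a b) (⊔-lub a≤k b≤k)

goodStar⇒labeling : ∀ {k f} → (∀ u → InRange k (f u)) → (∀ u → GoodStar (f u) (star f u)) →
                    IsTotalDiffLabeling ΩS k f
goodStar⇒labeling {f = f} range good = record
  { vertexRange  = range
  ; edgeRange    = λ {u} {v} adj → difference-inRange (range u) (range v) (proj₁ (goodEdge adj))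
  ; vertexProper = λ adj → proj₁ (goodEdge adj)
  ; edgeProper   = edgeProper
  ; edgeVertex   = λ adj → proj₁ (proj₂ (goodEdge adj))
  }
  where
  goodEdge : ∀ {u v} → SqAdj u v → GoodEdge (f u) (f v)
  goodEdge {u} {v} adj =
    let i , v≡step = adjacent⇒step {u} {v} adj
    in subst (λ v → GoodEdge (f u) (f v)) (sym v≡step) (proj₁ (good u) i)
  edgeProper : ∀ {u v w} → SqAdj u v → SqAdj u w → v ≢ w → ∣ f u - f v ∣ ≢ ∣ f u - f w ∣
  edgeProper {u} {v} {w} adj₁ adj₂ v≢w =
    let i , v≡step = adjacent⇒step {u} {v} adj₁
        j , w≡step = adjacent⇒step {u} {w} adj₂
        i≢j i≡j = v≢w (trans v≡step (trans (cong (λ i → step i u) i≡j) (sym w≡step)))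
    in subst₂ (λ v w → ∣ f u - f v ∣ ≢ ∣ f u - f w ∣) (sym v≡step) (sym w≡step) (proj₂ (good u) i j i≢j)

no-labeling≤7 : ∀ {k f} → k ≤ 7 → ¬ IsTotalDiffLabeling ΩS k f
no-labeling≤7 {f = f} k≤7 proper = ¬Any[] (f∈[] (+ 0 , + 0))
  where
  open IsTotalDiffLabeling proper
  f∈Labels7 : ∀ u → f u ∈ Labels 7
  f∈Labels7 u = inRange⇒∈Labels (proj₁ (vertexRange u) , ≤-trans (proj₂ (vertexRange u)) k≤7)
  peel′ : ∀ {S S'} → CentresIn S S' → (∀ u → f u ∈ S) → ∀ u → f u ∈ S'
  peel′ = peel step f (labeling⇒goodStar proper)
  f∈[] : ∀ u → f u ∈ []
  f∈[] = peel′ centres₃ (peel′ centres₂ (peel′ centres₁ f∈Labels7))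

next prev : Fin 6 → Fin 6
next 0F = 1F
next 1F = 2F
next 2F = 3F
next 3F = 4F
next 4F = 5F
next 5F = 0F
prev 0F = 5F
prev 1F = 0F
prev 2F = 1F
prev 3F = 2F
prev 4F = 3F
prev 5F = 4F

next∘prev : ∀ r → next (prev r) ≡ r
next∘prev 0F = refl
next∘prev 1F = refl
next∘prev 2F = refl
next∘prev 3F = refl
next∘prev 4F = refl
next∘prev 5F = refl

prev∘next : ∀ r → prev (next r) ≡ r
prev∘next 0F = refl
prev∘next 1F = refl
prev∘next 2F = refl
prev∘next 3F = refl
prev∘next 4F = refl
prev∘next 5F = refl

residue : ℤ → Fin 6
residue (+ zero) = 0F
residue (+ suc n) = next (residue (+ n))
residue -[1+ zero ] = 5F
residue -[1+ suc n ] = prev (residue -[1+ n ])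

residue-suc : ∀ z → residue (z + + 1) ≡ next (residue z)
residue-suc (+ n) = cong (λ m → residue (+ m)) (+-comm n 1)
residue-suc -[1+ zero ] = refl
residue-suc -[1+ suc n ] = sym (next∘prev (residue -[1+ n ]))

residue-pred : ∀ z → residue (z - + 1) ≡ prev (residue z)
residue-pred z = begin
  residue (z - + 1)                ≡⟨ prev∘next (residue (z - + 1)) ⟨
  prev (next (residue (z - + 1)))  ≡⟨ cong prev (residue-suc (z - + 1)) ⟨
  prev (residue (z - + 1 + + 1))   ≡⟨ cong (prev ∘ residue) (cancel z) ⟩
  prev (residue z)                 ∎
  where
  open ≡-Reasoning
  cancel : ∀ z → z - + 1 + + 1 ≡ z
  cancel = solve-∀

key : Point → ℤ
key (x , y) = x + + 2 * y

shift : Fin 4 → Fin 6 → Fin 6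
shift 0F = next
shift 1F = prev
shift 2F = next ∘ next
shift 3F = prev ∘ prev

residue-step : ∀ i u → residue (key (step i u)) ≡ shift i (residue (key u))
residue-step 0F (x , y) = trans (cong residue (key+1 x y)) (residue-suc (key (x , y)))
  where
  key+1 : ∀ x y → (x + + 1) + + 2 * (y + + 0) ≡ x + + 2 * y + + 1
  key+1 = solve-∀
residue-step 1F (x , y) = trans (cong residue (key-1 x y)) (residue-pred (key (x , y)))
  where
  key-1 : ∀ x y → (x + -[1+ 0 ]) + + 2 * (y + + 0) ≡ x + + 2 * y - + 1
  key-1 = solve-∀
residue-step 2F (x , y) =
  trans (cong residue (key+2 x y)) (trans (residue-suc (key (x , y) + + 1)) (cong next (residue-suc (key (x , y)))))
  where
  key+2 : ∀ x y → (x + + 0) + + 2 * (y + + 1) ≡ x + + 2 * y + + 1 + + 1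
  key+2 = solve-∀
residue-step 3F (x , y) =
  trans (cong residue (key-2 x y)) (trans (residue-pred (key (x , y) - + 1)) (cong prev (residue-pred (key (x , y)))))
  where
  key-2 : ∀ x y → (x + + 0) + + 2 * (y + -[1+ 0 ]) ≡ x + + 2 * y - + 1 - + 1
  key-2 = solve-∀

colour : Fin 6 → ℕ
colour 0F = 1
colour 1F = 3
colour 2F = 7
colour 3F = 2
colour 4F = 6
colour 5F = 8

colour-good : ∀ r → InRange 8 (colour r) × GoodStar (colour r) (λ i → colour (shift i r))
colour-good = from-yes (all? λ r → (1 ≤? colour r ×-dec colour r ≤? 8) ×-dec goodStar? (colour r) (λ i → colour (shift i r)))

label : Point → ℕ
label u = colour (residue (key u))

label-proper : IsTotalDiffLabeling ΩS 8 label
label-proper = goodStar⇒labeling (λ u → proj₁ (colour-good (residue (key u)))) good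
  where
  good : ∀ u → GoodStar (label u) (star label u)
  good u = GoodStar-resp (λ i → cong colour (sym (residue-step i u))) (proj₂ (colour-good (residue (key u))))

labeling⇒8≤k : ∀ k → HasTotalDiffLabeling ΩS k → 8 ≤ k
labeling⇒8≤k k (f , proper) with 8 ≤? k
... | yes 8≤k = 8≤k
... | no 8≰k with s≤s k≤7 ← ≰⇒> 8≰k = ⊥-elim (no-labeling≤7 k≤7 proper)

mainTheorem2 : χtd≡ ΩS 8
mainTheorem2 = (label , label-proper) , labeling⇒8≤k
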